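{- Let $\mathbb{K}$ be a field, $M\geqslant 2$ an integer, and let $x_0,x_1,\ldots,x_M$ be points of $\mathrm{PG}_M(\mathbb{K})$ in general position. Put $\Sigma_i=x_0\oplus\cdots\oplus x_i$ and $\pi_i=x_1\oplus\cdots\oplus x_i$. For $i=3,\ldots,M$ let $y_i$ be a point of the line $x_{i-1}\oplus x_i$ distinct from $x_{i-1},x_i$. Let $L$ be a finite set of lines of $\Sigma_2$, none equal to $\pi_2$, meeting $\pi_2$ in pairwise distinct points of $\pi_2\setminus\{x_2\}$, labelled $\ell_{(1)},\ldots,\ell_{(|L|)}$. Let $m$ be a line of $\Sigma_2$ through $x_2$ with $m\neq\pi_2$. For disjoint ordered subsets $J=(a_1,\ldots,a_j)$ and $\overline{J}=(\overline{a}_1,\ldots,\overline{a}_j)$ of $\{1,\ldots,|L|\}$ of the same size $j$, $1\leqslant j\leqslant M-1$, such that $\ell_{(a_i)}\cap\ell_{(\overline{a}_i)}\cap m$ is a point for every $i$, define the point $z_{J,\overline{J},m}$ by $z_{(a_1),(\overline{a}_1),m}=\ell_{(a_1)}\cap\ell_{(\overline{a}_1)}\cap m$ if $j=1$, and, if $j\geqslant 2$, writing $J=(\ldots,b,a)$ and $\overline{J}=(\ldots,\overline{b},\overline{a})$, $$z_{J,\overline{J},m}=(x_{j+1}\oplus z_{J\setminus\{a\},\overline{J}\setminus\{\overline{a}\},m})\cap(y_{j+1}\oplus z_{J\setminus\{b\},\overline{J}\setminus\{\overline{b}\},m}).$$ Let $J,\overline{J}$ be such a pair with $j\geqslant 1$,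 and let $J'=(a'_1,\ldots,a'_j)$ and $\overline{J}'=(\overline{a}'_1,\ldots,\overline{a}'_j)$ be disjoint ordered $j$-subsets of $\{1,\ldots,|L|\}$ such that for each $i=1,\ldots,j$ the $i$-th elements $a'_i$ and $\overline{a}'_i$ are each either $a_i$ or $\overline{a}_i$. Then $z_{J,\overline{J},m}=z_{J',\overline{J}',m}$.
   Context: For non-intersecting subspaces $x,y$ of a projective space, $x\oplus y$ denotes the subspace they span. An ordered subset of $\{1,\ldots,|L|\}$ is a finite sequence of pairwise distinct elements; $J\setminus\{a\}$ is obtained by deleting the entry $a$ and keeping the order of the remaining entries. -}

module Defs where

open import Level using (Level; _⊔_) renaming (suc to lsuc)
open import Algebra.Bundles using (CommutativeRing)
open import Data.Nat using (ℕ; zero; suc; _<_; _≤_)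
open import Data.Fin using (Fin; toℕ) renaming (zero to fzero; suc to fsuc)
open import Data.Vec using (Vec; []; _∷_; _∷ʳ_; lookup)
open import Data.Product using (Σ; ∃; ∃-syntax; _×_; _,_)
open import Relation.Nullary using (¬_)
open import Relation.Binary.PropositionalEquality using (_≡_)

record Field (c ℓ : Level) : Set (lsuc (c ⊔ ℓ)) where
  field
    commutativeRing : CommutativeRing c ℓ
  open CommutativeRing commutativeRing public
  field
    0≉1     : ¬ (0# ≈ 1#)
    inverse : ∀ x → ¬ (x ≈ 0#) → ∃[ y ] (x * y ≈ 1#)

-- Projective geometry PG_M(K), with M = 2 + N, modelled on K^(M+1) = K^(3+N).
-- A point is represented by a nonzero vector; subspaces are predicates on vectors.
module Geom {c ℓ : Level} (F : Field c ℓ) (N : ℕ) where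
  open Field F

  Dim : ℕ
  Dim = suc (suc (suc N))

  V : Set c
  V = Fin Dim → Carrier

  Subspace : Set (lsuc (c ⊔ ℓ))
  Subspace = V → Set (c ⊔ ℓ)

  _≈ᵥ_ : V → V → Set ℓ
  u ≈ᵥ v = ∀ i → u i ≈ v i

  _·_ : Carrier → V → V
  (a · v) i = a * v i

  _⊕ᵥ_ : V → V → V
  (u ⊕ᵥ v) i = u i + v i

  NonZeroV : V → Set ℓ
  NonZeroV v = ¬ (∀ i → v i ≈ 0#)

  SamePoint : V → V → Set (c ⊔ ℓ)
  SamePoint u v = ∃[ a ] (¬ (a ≈ 0#) × (u ≈ᵥ (a · v)))

  sumFin : (k : ℕ) → (Fin k → Carrier) → Carrier
  sumFin zero    f = 0#
  sumFin (suc k) f = f fzero + sumFin k (λ i → f (fsuc i))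

  lincomb : (Fin Dim → Carrier) → (Fin Dim → V) → V
  lincomb a x i = sumFin Dim (λ k → a k * x k i)

  GeneralPosition : (Fin Dim → V) → Set (c ⊔ ℓ)
  GeneralPosition x = ∀ a → (∀ i → lincomb a x i ≈ 0#) → ∀ k → a k ≈ 0#

  span2 : V → V → Subspace
  span2 u v p = ∃[ a ] ∃[ b ] (p ≈ᵥ ((a · u) ⊕ᵥ (b · v)))

  SigmaSp : (Fin Dim → V) → Fin Dim → Subspace
  SigmaSp x i p = ∃[ a ] ((∀ k → toℕ i < toℕ k → a k ≈ 0#) × (p ≈ᵥ lincomb a x))

  _⊆_ : Subspace → Subspace → Set (c ⊔ ℓ)
  S ⊆ T = ∀ p → S p → T p

  SameSubspace : Subspace → Subspace → Set (c ⊔ ℓ)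
  SameSubspace S T = (S ⊆ T) × (T ⊆ S)

  record Line : Set c where
    constructor mkLine
    field
      u v : V

  ⟦_⟧ : Line → Subspace
  ⟦ mkLine u v ⟧ = span2 u v

  IsLine : Line → Set (c ⊔ ℓ)
  IsLine (mkLine u v) = NonZeroV u × NonZeroV v × ¬ SamePoint u v

  -- The points z_{J,J̄,m}, as a relation:  Z j J J̄ p  means that z_{J,J̄,m} is
  -- defined (every intersection in the recursive definition is a point) and is
  -- the point represented by p.
  module Zdef (x y : Fin Dim → V) {n : ℕ} (ℓs : Fin n → Line) (m : Line) where
    data Z : (j : ℕ) → Vec (Fin n) j → Vec (Fin n) j → V → Set (c ⊔ ℓ) where
      base : ∀ (a a̅ : Fin n) (p : V) → NonZeroV p →
             ⟦ ℓs a ⟧ p → ⟦ ℓs a̅ ⟧ p → ⟦ m ⟧ p →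
             Z 1 (a ∷ []) (a̅ ∷ []) p
      step : ∀ (k : ℕ) (K K̅ : Vec (Fin n) k) (b a b̅ a̅ : Fin n) (p z₁ z₂ : V)
             (i : Fin Dim) → toℕ i ≡ suc (suc (suc k)) →
             -- z₁ = z_{J∖{a}, J̄∖{ā}, m},  z₂ = z_{J∖{b}, J̄∖{b̄}, m}
             Z (suc k) (K ∷ʳ b) (K̅ ∷ʳ b̅) z₁ →
             Z (suc k) (K ∷ʳ a) (K̅ ∷ʳ a̅) z₂ →
             ¬ SamePoint (x i) z₁ → ¬ SamePoint (y i) z₂ →
             ¬ SameSubspace (span2 (x i) z₁) (span2 (y i) z₂) →
             NonZeroV p → span2 (x i) z₁ p → span2 (y i) z₂ p →
             Z (suc (suc k)) ((K ∷ʳ b) ∷ʳ a) ((K̅ ∷ʳ b̅) ∷ʳ a̅) p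

-- ordered subsets: sequences with pairwise distinct entries
Distinct : ∀ {n j} → Vec (Fin n) j → Set
Distinct {j = j} J = ∀ (p q : Fin j) → lookup J p ≡ lookup J q → p ≡ q

Disjoint : ∀ {n j k} → Vec (Fin n) j → Vec (Fin n) k → Set
Disjoint {j = j} {k} J K = ∀ (p : Fin j) (q : Fin k) → ¬ (lookup J p ≡ lookup K q)

module Submission where

-- The point z_{J,J̄,m} depends on the pairs (a_i, ā_i) only through the lines
-- ℓ_(a_i), ℓ_(ā_i) that the base points lie on, and it does so symmetrically:
-- the base point ℓ_(a) ∩ ℓ_(ā) ∩ m lies on both lines, and the recursive step
-- only refers to the two sub-configurations obtained by deleting the last or
-- the penultimate entry.  Hence, by induction on the derivation of z_{J,J̄,m},
-- any J′ whose i-th entry is a_i or ā_i for every i, paired with any J̄′ with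
-- the same property, defines the same point.

open import Defs
open import Data.Nat using (ℕ; suc; _≤_)
open import Data.Fin using (Fin; toℕ; inject₁) renaming (zero to fzero; suc to fsuc)
open import Data.Vec using (Vec; lookup; []; _∷_; _∷ʳ_; initLast)
open import Data.Product using (Σ-syntax; _×_; _,_; proj₁; proj₂)
open import Data.Sum using (_⊎_; inj₁; inj₂)
open import Relation.Nullary using (¬_)
open import Relation.Binary.PropositionalEquality using (_≡_; refl)

Choice : {A : Set} → A → A → A → Set
Choice u v w = w ≡ u ⊎ w ≡ v

ChosenFrom : {A : Set} {j : ℕ} → Vec A j → Vec A j → Vec A j → Set
ChosenFrom {j = j} X Y W = ∀ (i : Fin j) → Choice (lookup X i) (lookup Y i) (lookup W i)

module _ {A : Set} where

  chosen-init : ∀ {j} (X Y W : Vec A j) {u v w : A} →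
    ChosenFrom (X ∷ʳ u) (Y ∷ʳ v) (W ∷ʳ w) → ChosenFrom X Y W
  chosen-init (_ ∷ X) (_ ∷ Y) (_ ∷ W) r fzero    = r fzero
  chosen-init (_ ∷ X) (_ ∷ Y) (_ ∷ W) r (fsuc i) = chosen-init X Y W (λ k → r (fsuc k)) i

  chosen-last : ∀ {j} (X Y W : Vec A j) {u v w : A} →
    ChosenFrom (X ∷ʳ u) (Y ∷ʳ v) (W ∷ʳ w) → Choice u v w
  chosen-last []      []      []      r = r fzero
  chosen-last (_ ∷ X) (_ ∷ Y) (_ ∷ W) r = chosen-last X Y W (λ k → r (fsuc k))

  chosen-snoc : ∀ {j} (X Y W : Vec A j) {u v w : A} →
    ChosenFrom X Y W → Choice u v w → ChosenFrom (X ∷ʳ u) (Y ∷ʳ v) (W ∷ʳ w)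
  chosen-snoc []      []      []      r c fzero    = c
  chosen-snoc (_ ∷ X) (_ ∷ Y) (_ ∷ W) r c fzero    = r fzero
  chosen-snoc (_ ∷ X) (_ ∷ Y) (_ ∷ W) r c (fsuc i) =
    chosen-snoc X Y W (λ k → r (fsuc k)) c i

  -- Deleting the penultimate entries preserves the choice: this is the passage
  -- from (J, J̄) to (J ∖ {b}, J̄ ∖ {b̄}) in the recursion defining z.
  chosen-dropPenultimate : ∀ {j} (X Y W : Vec A j) {b b̅ b′ a a̅ a′ : A} →
    ChosenFrom ((X ∷ʳ b) ∷ʳ a) ((Y ∷ʳ b̅) ∷ʳ a̅) ((W ∷ʳ b′) ∷ʳ a′) →
    ChosenFrom (X ∷ʳ a) (Y ∷ʳ a̅) (W ∷ʳ a′)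
  chosen-dropPenultimate X Y W r =
    chosen-snoc X Y W
      (chosen-init X Y W (chosen-init (X ∷ʳ _) (Y ∷ʳ _) (W ∷ʳ _) r))
      (chosen-last (X ∷ʳ _) (Y ∷ʳ _) (W ∷ʳ _) r)

module _ {c ℓ} (F : Field c ℓ) (N : ℕ) where
  open Geom F N

  module _ (x y : Fin Dim → V) {n : ℕ} (ℓs : Fin n → Line) (m : Line) where
    open Zdef x y ℓs m

    Z-respects-choice : ∀ {j} (J J̅ J′ J̅′ : Vec (Fin n) j) {p : V} →
      ChosenFrom J J̅ J′ → ChosenFrom J J̅ J̅′ → Z j J J̅ p → Z j J′ J̅′ p
    Z-respects-choice _ _ (a′ ∷ []) (a̅′ ∷ []) {p} r r̅ (base a a̅ _ p≠0 p∈ℓa p∈ℓa̅ p∈m) =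
      base a′ a̅′ p p≠0 (onChosenLine (r fzero)) (onChosenLine (r̅ fzero)) p∈m
      where
      onChosenLine : ∀ {w} → Choice a a̅ w → ⟦ ℓs w ⟧ p
      onChosenLine (inj₁ refl) = p∈ℓa
      onChosenLine (inj₂ refl) = p∈ℓa̅
    Z-respects-choice _ _ J′ J̅′ r r̅
      (step k K K̅ b a b̅ a̅ p z₁ z₂ i i≡ z₁-def z₂-def x≠z₁ y≠z₂ lines≠ p≠0 p∈xz₁ p∈yz₂)
      with initLast J′ | initLast J̅′
    ... | W , a′ , refl | W̅ , a̅′ , refl with initLast W | initLast W̅
    ... | K′ , b′ , refl | K̅′ , b̅′ , refl =
      step k K′ K̅′ b′ a′ b̅′ a̅′ p z₁ z₂ i i≡
        (Z-respects-choice (K ∷ʳ b) (K̅ ∷ʳ b̅) (K′ ∷ʳ b′) (K̅′ ∷ʳ b̅′)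
          (chosen-init (K ∷ʳ b) (K̅ ∷ʳ b̅) (K′ ∷ʳ b′) r)
          (chosen-init (K ∷ʳ b) (K̅ ∷ʳ b̅) (K̅′ ∷ʳ b̅′) r̅) z₁-def)
        (Z-respects-choice (K ∷ʳ a) (K̅ ∷ʳ a̅) (K′ ∷ʳ a′) (K̅′ ∷ʳ a̅′)
          (chosen-dropPenultimate K K̅ K′ r)
          (chosen-dropPenultimate K K̅ K̅′ r̅) z₂-def)
        x≠z₁ y≠z₂ lines≠ p≠0 p∈xz₁ p∈yz₂

lemma2p5 : ∀ {c ℓ} (F : Field c ℓ) (N : ℕ) →
  let open Geom F N in
  (x : Fin Dim → V) → GeneralPosition x →
  (y : Fin Dim → V) →
  -- y_{i+1}, for i+1 = 3, ..., M, is a point of x_i ⊕ x_{i+1} distinct from both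
  (∀ (i : Fin (suc (suc N))) → 2 ≤ toℕ i →
    NonZeroV (y (fsuc i)) × span2 (x (inject₁ i)) (x (fsuc i)) (y (fsuc i))
    × ¬ SamePoint (y (fsuc i)) (x (inject₁ i)) × ¬ SamePoint (y (fsuc i)) (x (fsuc i))) →
  let Σ₂ = SigmaSp x (fsuc (fsuc fzero))
      π₂ = span2 (x (fsuc fzero)) (x (fsuc (fsuc fzero)))
      x₂ = x (fsuc (fsuc fzero))
  in
  (n : ℕ) (ℓs : Fin n → Line) →
  (∀ k → IsLine (ℓs k) × (⟦ ℓs k ⟧ ⊆ Σ₂) × ¬ SameSubspace ⟦ ℓs k ⟧ π₂) →
  (Σ[ q ∈ (Fin n → V) ] ((∀ k → NonZeroV (q k) × ⟦ ℓs k ⟧ (q k) × π₂ (q k) × ¬ SamePoint (q k) x₂)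
           × (∀ k k' → ¬ (k ≡ k') → ¬ SamePoint (q k) (q k')))) →
  (m : Line) → IsLine m → (⟦ m ⟧ ⊆ Σ₂) → ⟦ m ⟧ x₂ → ¬ SameSubspace ⟦ m ⟧ π₂ →
  let open Zdef x y ℓs m in
  (j : ℕ) → 1 ≤ j → j ≤ suc N →
  (J J̅ J′ J̅′ : Vec (Fin n) j) →
  Distinct J → Distinct J̅ → Disjoint J J̅ →
  (∀ i → Σ[ p ∈ V ] (NonZeroV p × ⟦ ℓs (lookup J i) ⟧ p × ⟦ ℓs (lookup J̅ i) ⟧ p × ⟦ m ⟧ p)) →
  Distinct J′ → Distinct J̅′ → Disjoint J′ J̅′ →
  (∀ i → (lookup J′ i ≡ lookup J i ⊎ lookup J′ i ≡ lookup J̅ i)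
         × (lookup J̅′ i ≡ lookup J i ⊎ lookup J̅′ i ≡ lookup J̅ i)) →
  ∀ p → Z j J J̅ p → Z j J′ J̅′ p
lemma2p5 F N x _ y _ n ℓs _ _ m _ _ _ _ j _ _ J J̅ J′ J̅′ _ _ _ _ _ _ _ choices p =
  Z-respects-choice F N x y ℓs m J J̅ J′ J̅′
    (λ i → proj₁ (choices i)) (λ i → proj₂ (choices i))
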